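{- For every table $T\in\mathcal{M}_k^2\setminus\mathcal{M}_k^2\mathcal{C}$, $h^d(T)>\log_k\Theta(T)$.
   Context: Fix an integer $k\ge 2$; $E_k=\{0,\ldots,k-1\}$, $E_2=\{0,1\}$, $P=\{f_i:i\in\{0,1,2,\ldots\}\}$ a set of attribute names. $\mathcal{M}_k^2$ is the set of rectangular tables filled with numbers from $E_k$, columns labeled with pairwise different attributes from $P$, rows pairwise different, each row labeled with a decision from $E_2$; the table without rows is denoted $\Lambda$. $P(T)$ is the set of column attributes. $\mathcal{M}_k^2\mathcal{C}$ is the set of tables in which all rows have the same decision ($\Lambda$ included). $T(f_{i_1},\delta_1)\cdots(f_{i_m},\delta_m)$ is the table of rows of $T$ having values $\delta_1,\ldots,\delta_m$ in the columns labeled $f_{i_1},\ldots,f_{i_m}$. A test of $T$ is $D\subseteq P(T)$ such that any two rows of $T$ with different decisions differ in some column labeled by an attribute of $D$. $\Theta(T)$ is the minimum cardinality of a test of $T$. A $k$-decision tree: finite directed rooted tree with at least two nodes, root and its leaving edges unlabeled, terminal nodes labeled with decisions from $E_2$, other nodes labeled with attributes from $P$ whose leaving edges are labeled with numbers from $E_k$; $P(\Gamma)$ is the set of attributes labeling nodes. For a complete path $\tau=v_1,d_1,\ldots,v_m,d_m,v_{m+1}$ (root to terminal node), $T(\tau)=T$ if $m=1$, else $T(f_{i_2},\delta_2)\cdots(f_{i_m},\delta_m)$ where $v_j$ is labeled $f_{i_j}$ and $d_j$ is labeled $\delta_j$. The depth $h(\Gamma)$ is the maximum of $m-1$ over complete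 paths. For $T\ne\Lambda$, a deterministic decision tree for $T$: exactly one edge leaves the root, edges leaving any other nonterminal node have pairwise different labels, $P(\Gamma)\subseteq P(T)$, every row of $T$ lies in some $T(\tau)$, and for every complete path either $T(\tau)=\Lambda$ or all rows of $T(\tau)$ have the terminal node's decision. $h^d(T)$ is the minimum depth of a deterministic decision tree for $T$. -}

module Defs where

open import Data.Nat using (ℕ; zero; suc; _≤_; _<_; _⊔_; _^_)
open import Data.Fin using (Fin)
open import Data.Vec using (Vec; lookup)
open import Data.List using (List; map; length; foldr)
open import Data.List.Membership.Propositional using (_∈_)
open import Data.List.Relation.Unary.All using (All)
open import Data.List.Relation.Unary.Unique.Propositional using (Unique)
open import Data.Maybe using (Maybe; just; nothing)
open import Data.Product using (Σ; ∃; ∃-syntax; _×_; _,_; proj₁; proj₂)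
open import Data.Sum using (_⊎_)
open import Relation.Binary.PropositionalEquality using (_≡_; _≢_)
open import Relation.Nullary using (¬_)
open import Data.Fin using (zero; suc)
open import Data.List using (allFin)

-- Attributes f_i are represented by their index i : ℕ.
-- Decisions are E_2 = Fin 2; values are E_k = Fin k.

record Table (k : ℕ) : Set where
  field
    n        : ℕ
    attrs    : Vec ℕ n
    attrsDistinct : ∀ (j j′ : Fin n) → lookup attrs j ≡ lookup attrs j′ → j ≡ j′
    rows     : List (Vec (Fin k) n × Fin 2)
    rowsDistinct : Unique (map proj₁ rows)
open Table public

module _ {k : ℕ} (T : Table k) where

  Row : Set
  Row = Vec (Fin k) (n T) × Fin 2

  InP : ℕ → Set
  InP i = ∃[ j ] lookup (attrs T) j ≡ i

  HasVal : Row → ℕ → Fin k → Set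
  HasVal r i δ = ∃[ j ] (lookup (attrs T) j ≡ i × lookup (proj₁ r) j ≡ δ)

  DifferAt : Row → Row → ℕ → Set
  DifferAt r r′ i = ∃[ j ] (lookup (attrs T) j ≡ i × lookup (proj₁ r) j ≢ lookup (proj₁ r′) j)

  -- T ∈ M_k^2 C : all rows have the same decision
  Const : Set
  Const = ∀ r r′ → r ∈ rows T → r′ ∈ rows T → proj₂ r ≡ proj₂ r′

  IsTest : List ℕ → Set
  IsTest D = Unique D × All InP D ×
    (∀ r r′ → r ∈ rows T → r′ ∈ rows T → proj₂ r ≢ proj₂ r′ →
       ∃[ i ] (i ∈ D × DifferAt r r′ i))

  IsΘ : ℕ → Set
  IsΘ θ = (∃[ D ] (IsTest D × length D ≡ θ)) × (∀ D → IsTest D → θ ≤ length D)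

-- The part of a k-decision tree below the (unlabeled) root, for trees in which
-- exactly one edge leaves the root and edges leaving any nonterminal node have
-- pairwise different labels: at an attribute node, for each label δ ∈ E_k there
-- is at most one leaving edge (child δ = just t) or none (nothing).
data DTree (k : ℕ) : Set where
  leaf : Fin 2 → DTree k
  node : ℕ → (Fin k → Maybe (DTree k)) → DTree k

-- complete paths (the number of `step`s is m - 1)
data Path {k : ℕ} : DTree k → Set where
  here : ∀ d → Path (leaf d)
  step : ∀ i ch (δ : Fin k) t → ch δ ≡ just t → Path t → Path (node i ch)

terminal : ∀ {k} {Γ : DTree k} → Path Γ → Fin 2
terminal (here d) = d
terminal (step _ _ _ _ _ p) = terminal p

pathLen : ∀ {k} {Γ : DTree k} → Path Γ → ℕ
pathLen (here _) = 0
pathLen (step _ _ _ _ _ p) = suc (pathLen p)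

-- well-formedness: every nonterminal node has at least one leaving edge
-- (terminal nodes are exactly the decision-labeled leaves)
data WF {k : ℕ} : DTree k → Set where
  wf-leaf : ∀ d → WF (leaf d)
  wf-node : ∀ i ch → (∃[ δ ] ∃[ t ] ch δ ≡ just t) →
            (∀ δ t → ch δ ≡ just t → WF t) → WF (node i ch)

data AttrOf {k : ℕ} (i : ℕ) : DTree k → Set where
  at-node : ∀ ch → AttrOf i (node i ch)
  below   : ∀ j ch δ t → ch δ ≡ just t → AttrOf i t → AttrOf i (node j ch)

IsDepth : ∀ {k} → DTree k → ℕ → Set
IsDepth Γ h = (∃[ p ] pathLen {Γ = Γ} p ≡ h) × (∀ (p : Path Γ) → pathLen p ≤ h)

module _ {k : ℕ} (T : Table k) where

  InSub : Row T → ∀ {Γ : DTree k} → Path Γ → Set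
  InSub r (here _) = Data.Unit.⊤ where import Data.Unit
  InSub r (step i _ δ _ _ p) = HasVal T r i δ × InSub r p

  Deterministic : DTree k → Set
  Deterministic Γ =
    WF Γ ×
    (∀ i → AttrOf i Γ → InP T i) ×
    (∀ r → r ∈ rows T → ∃[ τ ] InSub r {Γ} τ) ×
    (∀ (τ : Path Γ) →
       (∀ r → r ∈ rows T → ¬ InSub r τ) ⊎
       (∀ r → r ∈ rows T → InSub r τ → proj₂ r ≡ terminal τ))

  IsHd : ℕ → Set
  IsHd h = (∃[ Γ ] (Deterministic Γ × IsDepth Γ h)) ×
           (∀ Γ h′ → Deterministic Γ → IsDepth Γ h′ → h ≤ h′)

{-# OPTIONS --safe #-}
-- The attributes of a deterministic decision tree Γ for T form a test: two rows with
-- different decisions cannot both follow a complete path to the end, so they are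
-- separated at some node of the path taken by one of them. A tree of depth h with
-- k-ary branching has at most 1 + k + ⋯ + k^(h-1) < k^h attribute nodes, hence
-- Θ(T) ≤ |P(Γ)| < k^h.
module Submission where

open import Defs
open import Data.Nat using (ℕ; _≤_; _<_; _^_)
open import Relation.Nullary using (¬_)

open import Data.Nat using (zero; suc; _+_; _*_; z≤n; s≤s)
open import Data.Nat.Properties
open import Data.Fin using (Fin)
import Data.Fin.Properties as Fin
open import Data.Vec using (lookup)
open import Data.List using (List; []; _∷_; _++_; length; concatMap; allFin; deduplicate)
open import Data.List.Properties using (length-++; length-tabulate; length-deduplicate)
open import Data.List.Membership.Propositional using (_∈_; lose; find)
open import Data.List.Membership.Propositional.Properties
  using (∈-allFin; ∈-concatMap⁺; ∈-concatMap⁻; ∈-deduplicate⁺; ∈-deduplicate⁻)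
open import Data.List.Relation.Unary.Any using (here; there)
import Data.List.Relation.Unary.All as All
open import Data.List.Relation.Unary.Unique.DecPropositional.Properties using (deduplicate-!)
open import Data.Maybe using (Maybe; just; nothing)
open import Data.Product using (∃-syntax; _×_; _,_; proj₁; proj₂)
open import Data.Sum using (_⊎_; inj₁; inj₂)
open import Data.Empty using (⊥-elim)
open import Data.Unit using (tt)
open import Relation.Nullary using (yes; no)
open import Relation.Binary.PropositionalEquality

mutual
  attributes : ∀ {k} → DTree k → List ℕ
  attributes (leaf _)    = []
  attributes (node i ch) = i ∷ concatMap (λ δ → attributesᴹ (ch δ)) (allFin _)

  attributesᴹ : ∀ {k} → Maybe (DTree k) → List ℕ
  attributesᴹ nothing  = []
  attributesᴹ (just t) = attributes t

∈-attributes⁺ : ∀ {k i} {Γ : DTree k} → AttrOf i Γ → i ∈ attributes Γ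
∈-attributes⁺ (at-node _) = here refl
∈-attributes⁺ {i = i} (below _ ch δ t eq a) =
  there (∈-concatMap⁺ _ (lose (∈-allFin δ) i∈δ))
  where
    i∈δ : i ∈ attributesᴹ (ch δ)
    i∈δ rewrite eq = ∈-attributes⁺ a

∈-attributes⁻ : ∀ {k i} (Γ : DTree k) → i ∈ attributes Γ → AttrOf i Γ
∈-attributes⁻ (node i ch) (here refl) = at-node ch
∈-attributes⁻ {k} (node j ch) (there m)
  with find (∈-concatMap⁻ (λ δ → attributesᴹ (ch δ)) {allFin k} m)
... | δ , _ , i∈δ with ch δ in eq
...   | just t = below j ch δ t eq (∈-attributes⁻ t i∈δ)

length-concatMap-≤ : ∀ {A B : Set} (f : A → List B) {K} → (∀ x → length (f x) < K) →
                     ∀ xs → length (concatMap f xs) + length xs ≤ length xs * K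
length-concatMap-≤ f f<K [] = z≤n
length-concatMap-≤ f {K} f<K (x ∷ xs) = begin
  length (f x ++ rest) + suc (length xs)   ≡⟨ cong (_+ suc (length xs)) (length-++ (f x)) ⟩
  length (f x) + length rest + suc (length xs) ≡⟨ +-suc _ (length xs) ⟩
  suc (length (f x) + length rest + length xs) ≡⟨ cong suc (+-assoc (length (f x)) _ _) ⟩
  suc (length (f x)) + (length rest + length xs) ≤⟨ +-mono-≤ (f<K x) (length-concatMap-≤ f f<K xs) ⟩
  K + length xs * K ∎
  where
    open ≤-Reasoning
    rest : List _
    rest = concatMap f xs

^-positive : ∀ {k} → 2 ≤ k → ∀ b → 0 < k ^ b
^-positive {suc k} _ b = m^n>0 (suc k) b

somePath : ∀ {k} {Γ : DTree k} → WF Γ → Path Γ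
somePath (wf-leaf d) = here d
somePath (wf-node i ch (δ , t , eq) wf) = step i ch δ t eq (somePath (wf δ t eq))

length-attributes< : ∀ {k} → 2 ≤ k → {Γ : DTree k} → WF Γ →
                     ∀ b → (∀ p → pathLen {Γ = Γ} p ≤ b) → length (attributes Γ) < k ^ b
length-attributes< 2≤k (wf-leaf _) b _ = ^-positive 2≤k b
length-attributes< 2≤k (wf-node i ch (δ , t , eq) wf) zero depth≤0
  with () ← depth≤0 (step i ch δ t eq (somePath (wf δ t eq)))
length-attributes< {k} 2≤k (wf-node i ch _ wf) (suc b) depth≤b = begin
  suc (suc (length children))  ≡⟨ +-comm 2 _ ⟩
  length children + 2          ≤⟨ +-monoʳ-≤ _ 2≤k ⟩
  length children + k          ≤⟨ subst₂ (λ n m → length children + n ≤ m * k ^ b) |allFin| |allFin|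
                                    (length-concatMap-≤ attributesᴹ∘ch child< (allFin k)) ⟩
  k * k ^ b                    ∎
  where
    open ≤-Reasoning
    attributesᴹ∘ch : Fin k → List ℕ
    attributesᴹ∘ch δ = attributesᴹ (ch δ)
    children : List ℕ
    children = concatMap attributesᴹ∘ch (allFin k)
    |allFin| : length (allFin k) ≡ k
    |allFin| = length-tabulate (λ δ → δ)
    child< : ∀ δ → length (attributesᴹ (ch δ)) < k ^ b
    child< δ with ch δ in eq
    ... | nothing = ^-positive 2≤k b
    ... | just t  = length-attributes< 2≤k (wf δ t eq) b
                      (λ p → ≤-pred (depth≤b (step i ch δ t eq p)))

module _ {k : ℕ} (T : Table k) where

  InSub⇒InSub⊎DifferAt : ∀ r r′ {Γ : DTree k} (τ : Path Γ) → InSub T r τ →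
                         InSub T r′ τ ⊎ ∃[ i ] (AttrOf i Γ × DifferAt T r r′ i)
  InSub⇒InSub⊎DifferAt r r′ (here _) _ = inj₁ tt
  InSub⇒InSub⊎DifferAt r r′ (step i ch δ t eq τ) ((j , j↦i , r[j]≡δ) , r∈τ)
    with lookup (proj₁ r′) j Fin.≟ δ
  ... | no r′[j]≢δ =
    inj₂ (i , at-node ch , j , j↦i , λ r[j]≡r′[j] → r′[j]≢δ (trans (sym r[j]≡r′[j]) r[j]≡δ))
  ... | yes r′[j]≡δ with InSub⇒InSub⊎DifferAt r r′ τ r∈τ
  ...   | inj₁ r′∈τ        = inj₁ ((j , j↦i , r′[j]≡δ) , r′∈τ)
  ...   | inj₂ (i′ , a , d) = inj₂ (i′ , below i ch δ t eq a , d)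

  attributes-separate : ∀ {Γ} → Deterministic T Γ → ∀ r r′ → r ∈ rows T → r′ ∈ rows T →
                        proj₂ r ≢ proj₂ r′ → ∃[ i ] (i ∈ attributes Γ × DifferAt T r r′ i)
  attributes-separate (_ , _ , cover , decided) r r′ r∈T r′∈T r≢r′ with cover r r∈T
  ... | τ , r∈τ with InSub⇒InSub⊎DifferAt r r′ τ r∈τ
  ...   | inj₂ (i , a , d) = i , ∈-attributes⁺ a , d
  ...   | inj₁ r′∈τ with decided τ
  ...     | inj₁ empty   = ⊥-elim (empty r r∈T r∈τ)
  ...     | inj₂ uniform = ⊥-elim (r≢r′ (trans (uniform r r∈T r∈τ) (sym (uniform r′ r′∈T r′∈τ))))

  Θ≤length-attributes : ∀ {θ Γ} → IsΘ T θ → Deterministic T Γ → θ ≤ length (attributes Γ)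
  Θ≤length-attributes {Γ = Γ} (_ , minimal) det@(_ , attrs⊆P , _) =
    ≤-trans (minimal D D-isTest) (length-deduplicate _≟_ (attributes Γ))
    where
      D : List ℕ
      D = deduplicate _≟_ (attributes Γ)
      D-isTest : IsTest T D
      D-isTest =
        deduplicate-! _≟_ (attributes Γ) ,
        All.tabulate (λ i∈D → attrs⊆P _ (∈-attributes⁻ Γ (∈-deduplicate⁻ _≟_ _ i∈D))) ,
        λ r r′ r∈T r′∈T r≢r′ → let i , i∈Γ , d = attributes-separate det r r′ r∈T r′∈T r≢r′
                               in i , ∈-deduplicate⁺ _≟_ i∈Γ , d

lemma6 : (k : ℕ) → 2 ≤ k → (T : Table k) → ¬ Const T →
         ∀ θ h → IsΘ T θ → IsHd T h → θ < k ^ h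
-- ¬ Const T is unused: it only makes log_k Θ(T) defined in the paper (Θ(T) = 0 for
-- constant T), while θ < k ^ h holds for every table.
lemma6 k 2≤k T _ θ h isΘ ((Γ , det@(wf , _) , (_ , depth≤h)) , _) =
  ≤-<-trans (Θ≤length-attributes T isΘ det) (length-attributes< 2≤k wf h depth≤h)
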